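{- In any normal and neutral $\mathsf{IEL}^{ - }$-deduction of $A$ from the set $\Gamma$ of undischarged assumptions, $\Gamma\neq\varnothing$.
   Context: Formulas: built from propositional atoms and $\bot$ by $\wedge,\vee,\rightarrow$ and a unary modality $\Box$. $\mathsf{IEL}^{ - }$: NJ introduction/elimination rules for $\wedge,\vee,\rightarrow$, ex falso ($\bot$-elimination, an elimination rule), and the $\Box$-intro rule (an introduction rule): from deductions of $\Box A_1,\dots,\Box A_n$ and a deduction of $B$ from assumptions $A_1,\dots,A_n,\Delta$, infer $\Box B$, discharging $A_1,\dots,A_n$. A deduction is neutral iff it consists of a single assumption or its last rule is an elimination rule. Deductions are identified with typed proof terms $x\mid \lambda x.t\mid ts\mid \langle t,s\rangle\mid \pi_i t\mid \mathsf{in}_i t\mid \mathsf{C}_{x,y}(t,t_1,t_2)$ ($\vee$-elim) $\mid \mathsf{E}(t)$ ($\bot$-elim) $\mid \mathsf{B}_{x_1,\dots,x_n}(t_1,\dots,t_n)\,\mathsf{in}\,s$ ($\Box$-intro). A deduction is normal if its term contains no redex of: detours $(\lambda x.t)s> t[x:=s]$, $\pi_i\langle t_1,t_2\rangle> t_i$, $\mathsf{C}_{x_1,x_2}(\mathsf{in}_i t,t_1,t_2)> t_i[x_i:=t]$, $\mathsf{B}_{\dots,x_i,\dots}(\dots,(\mathsf{B}_{\vec y}(\vec s)\,\mathsf{in}\,t_i),\dots)\,\mathsf{in}\,r > \mathsf{B}_{\dots,\vec y,\dots}(\dots,\vec s,\dots)\,\mathsf{in}\,r[x_i:=t_i]$,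 $\mathsf{B}_x t\,\mathsf{in}\,x> t$; permutations $\mathsf{C}(t,t_1,t_2)s>\mathsf{C}(t,t_1s,t_2s)$, $\pi_i\mathsf{C}(t,t_1,t_2)>\mathsf{C}(t,\pi_it_1,\pi_it_2)$, $\mathsf{C}_{u,v}(\mathsf{C}_{x,y}(t,t_1,t_2),s_1,s_2)>\mathsf{C}_{x,y}(t,\mathsf{C}_{u,v}(t_1,s_1,s_2),\mathsf{C}_{u,v}(t_2,s_1,s_2))$, $\mathsf{B}_{\vec x}(\dots,\mathsf{C}_{x,y}(t,s_1,s_2),\dots)\,\mathsf{in}\,s>\mathsf{C}_{x,y}(t,\mathsf{B}_{\vec x}(\dots,s_1,\dots)\,\mathsf{in}\,s,\mathsf{B}_{\vec x}(\dots,s_2,\dots)\,\mathsf{in}\,s)$, $\mathsf{E}(\mathsf{C}(t,t_1,t_2))>\mathsf{C}(t,\mathsf{E}(t_1),\mathsf{E}(t_2))$; $\bot$-conversions $\mathsf{E}(t)s>\mathsf{E}(t)$, $\pi_i\mathsf{E}(t)>\mathsf{E}(t)$, $\mathsf{C}(\mathsf{E}(t),t_1,t_2)>\mathsf{E}(t)$, $\mathsf{E}(\mathsf{E}(t))>\mathsf{E}(t)$, $\mathsf{B}_{\vec x}(\dots,\mathsf{E}(t_i),\dots)\,\mathsf{in}\,s>\mathsf{E}(t_i)$. -}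

module Defs where

open import Data.Nat using (ℕ)
open import Data.List using (List; []; _∷_; _++_; map)
open import Data.Product using (_×_; Σ)
open import Data.Unit using (⊤)
open import Data.Empty using (⊥)
open import Relation.Nullary using (¬_)

infixr 6 _∧_
infixr 5 _∨_
infixr 4 _⇒_
data Form : Set where
  atom : ℕ → Form
  ⊥'   : Form
  _∧_  : Form → Form → Form
  _∨_  : Form → Form → Form
  _⇒_  : Form → Form → Form
  □    : Form → Form

Ctx : Set
Ctx = List Form

data _∋_ : Ctx → Form → Set where
  here  : ∀ {Γ A} → (A ∷ Γ) ∋ A
  there : ∀ {Γ A B} → Γ ∋ A → (B ∷ Γ) ∋ A

-- Typed proof terms = IEL⁻ deductions (intrinsically typed)
mutual
  data Tm (Γ : Ctx) : Form → Set where
    var  : ∀ {A} → Γ ∋ A → Tm Γ A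
    lam  : ∀ {A B} → Tm (A ∷ Γ) B → Tm Γ (A ⇒ B)
    app  : ∀ {A B} → Tm Γ (A ⇒ B) → Tm Γ A → Tm Γ B
    pair : ∀ {A B} → Tm Γ A → Tm Γ B → Tm Γ (A ∧ B)
    π₁   : ∀ {A B} → Tm Γ (A ∧ B) → Tm Γ A
    π₂   : ∀ {A B} → Tm Γ (A ∧ B) → Tm Γ B
    in₁  : ∀ {A B} → Tm Γ A → Tm Γ (A ∨ B)
    in₂  : ∀ {A B} → Tm Γ B → Tm Γ (A ∨ B)
    case : ∀ {A B C} → Tm Γ (A ∨ B) → Tm (A ∷ Γ) C → Tm (B ∷ Γ) C → Tm Γ C
    efq  : ∀ {C} → Tm Γ ⊥' → Tm Γ C
    -- □-intro: B_{x1..xn}(t1..tn) in s, with ti : □Ai, s : B from A1..An,Γ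
    box  : ∀ {As B} → Tms Γ (map □ As) → Tm (As ++ Γ) B → Tm Γ (□ B)

  data Tms (Γ : Ctx) : List Form → Set where
    []  : Tms Γ []
    _∷_ : ∀ {A As} → Tm Γ A → Tms Γ As → Tms Γ (A ∷ As)

data AnyTm {Γ : Ctx} (P : ∀ {A} → Tm Γ A → Set) : ∀ {As} → Tms Γ As → Set where
  hd : ∀ {A As} {t : Tm Γ A} {ts : Tms Γ As} → P t → AnyTm P (t ∷ ts)
  tl : ∀ {A As} {t : Tm Γ A} {ts : Tms Γ As} → AnyTm P ts → AnyTm P (t ∷ ts)

data IsBox {Γ : Ctx} : ∀ {A} → Tm Γ A → Set where
  isBox : ∀ {As B} {ts : Tms Γ (map □ As)} {s : Tm (As ++ Γ) B} → IsBox (box ts s)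

data IsCase {Γ : Ctx} : ∀ {A} → Tm Γ A → Set where
  isCase : ∀ {A B C} {t : Tm Γ (A ∨ B)} {t₁ : Tm (A ∷ Γ) C} {t₂ : Tm (B ∷ Γ) C} →
           IsCase (case t t₁ t₂)

data IsEfq {Γ : Ctx} : ∀ {A} → Tm Γ A → Set where
  isEfq : ∀ {C} {t : Tm Γ ⊥'} → IsEfq {A = C} (efq t)

data Redex {Γ : Ctx} : ∀ {A} → Tm Γ A → Set where
  β-⇒   : ∀ {A B} {t : Tm (A ∷ Γ) B} {s : Tm Γ A} → Redex (app (lam t) s)
  β-∧₁  : ∀ {A B} {t : Tm Γ A} {s : Tm Γ B} → Redex (π₁ (pair t s))
  β-∧₂  : ∀ {A B} {t : Tm Γ A} {s : Tm Γ B} → Redex (π₂ (pair t s))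
  β-∨₁  : ∀ {A B C} {t : Tm Γ A} {t₁ : Tm (A ∷ Γ) C} {t₂ : Tm (B ∷ Γ) C} →
          Redex (case (in₁ t) t₁ t₂)
  β-∨₂  : ∀ {A B C} {t : Tm Γ B} {t₁ : Tm (A ∷ Γ) C} {t₂ : Tm (B ∷ Γ) C} →
          Redex (case (in₂ t) t₁ t₂)
  β-□   : ∀ {As B} {ts : Tms Γ (map □ As)} {s : Tm (As ++ Γ) B} →
          AnyTm IsBox ts → Redex (box ts s)
  η-□   : ∀ {A} {t : Tm Γ (□ A)} → Redex (box {As = A ∷ []} (t ∷ []) (var here))
  p-app  : ∀ {A B C D} {t : Tm Γ (A ∨ B)} {t₁ : Tm (A ∷ Γ) (C ⇒ D)} {t₂ : Tm (B ∷ Γ) (C ⇒ D)}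
           {s : Tm Γ C} → Redex (app (case t t₁ t₂) s)
  p-π₁   : ∀ {A B C D} {t : Tm Γ (A ∨ B)} {t₁ : Tm (A ∷ Γ) (C ∧ D)} {t₂ : Tm (B ∷ Γ) (C ∧ D)} →
           Redex (π₁ (case t t₁ t₂))
  p-π₂   : ∀ {A B C D} {t : Tm Γ (A ∨ B)} {t₁ : Tm (A ∷ Γ) (C ∧ D)} {t₂ : Tm (B ∷ Γ) (C ∧ D)} →
           Redex (π₂ (case t t₁ t₂))
  p-case : ∀ {A B C D E} {t : Tm Γ (A ∨ B)} {t₁ : Tm (A ∷ Γ) (C ∨ D)} {t₂ : Tm (B ∷ Γ) (C ∨ D)}
           {s₁ : Tm (C ∷ Γ) E} {s₂ : Tm (D ∷ Γ) E} → Redex (case (case t t₁ t₂) s₁ s₂)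
  p-box  : ∀ {As B} {ts : Tms Γ (map □ As)} {s : Tm (As ++ Γ) B} →
           AnyTm IsCase ts → Redex (box ts s)
  p-efq  : ∀ {A B C} {t : Tm Γ (A ∨ B)} {t₁ : Tm (A ∷ Γ) ⊥'} {t₂ : Tm (B ∷ Γ) ⊥'} →
           Redex {A = C} (efq (case t t₁ t₂))
  e-app  : ∀ {C D} {t : Tm Γ ⊥'} {s : Tm Γ C} → Redex (app {A = C} {B = D} (efq t) s)
  e-π₁   : ∀ {C D} {t : Tm Γ ⊥'} → Redex (π₁ {A = C} {B = D} (efq t))
  e-π₂   : ∀ {C D} {t : Tm Γ ⊥'} → Redex (π₂ {A = C} {B = D} (efq t))
  e-case : ∀ {A B C} {t : Tm Γ ⊥'} {t₁ : Tm (A ∷ Γ) C} {t₂ : Tm (B ∷ Γ) C} →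
           Redex (case (efq t) t₁ t₂)
  e-efq  : ∀ {C} {t : Tm Γ ⊥'} → Redex {A = C} (efq (efq t))
  e-box  : ∀ {As B} {ts : Tms Γ (map □ As)} {s : Tm (As ++ Γ) B} →
           AnyTm IsEfq ts → Redex (box ts s)

mutual
  Normal : ∀ {Γ A} → Tm Γ A → Set
  Normal (var x)        = ⊤
  Normal (lam t)        = Normal t
  Normal (app t s)      = ¬ Redex (app t s) × Normal t × Normal s
  Normal (pair t s)     = Normal t × Normal s
  Normal (π₁ t)         = ¬ Redex (π₁ t) × Normal t
  Normal (π₂ t)         = ¬ Redex (π₂ t) × Normal t
  Normal (in₁ t)        = Normal t
  Normal (in₂ t)        = Normal t
  Normal (case t t₁ t₂) = ¬ Redex (case t t₁ t₂) × Normal t × Normal t₁ × Normal t₂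
  Normal {A = C} (efq t) = ¬ Redex (efq {C = C} t) × Normal t
  Normal (box {As} ts s) = ¬ Redex (box {As = As} ts s) × NormalTms ts × Normal s

  NormalTms : ∀ {Γ As} → Tms Γ As → Set
  NormalTms []       = ⊤
  NormalTms (t ∷ ts) = Normal t × NormalTms ts

data Neutral {Γ : Ctx} : ∀ {A} → Tm Γ A → Set where
  n-var  : ∀ {A} {x : Γ ∋ A} → Neutral (var x)
  n-app  : ∀ {A B} {t : Tm Γ (A ⇒ B)} {s : Tm Γ A} → Neutral (app t s)
  n-π₁   : ∀ {A B} {t : Tm Γ (A ∧ B)} → Neutral (π₁ t)
  n-π₂   : ∀ {A B} {t : Tm Γ (A ∧ B)} → Neutral (π₂ t)
  n-case : ∀ {A B C} {t : Tm Γ (A ∨ B)} {t₁ : Tm (A ∷ Γ) C} {t₂ : Tm (B ∷ Γ) C} →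
           Neutral (case t t₁ t₂)
  n-efq  : ∀ {C} {t : Tm Γ ⊥'} → Neutral {A = C} (efq t)

wkVar : ∀ {Γ A} (As : Ctx) → Γ ∋ A → (As ++ Γ) ∋ A
wkVar []       x = x
wkVar (_ ∷ As) x = there (wkVar As x)

mutual
  data Occurs {Γ : Ctx} {A : Form} (x : Γ ∋ A) : ∀ {B} → Tm Γ B → Set where
    o-var   : Occurs x (var x)
    o-lam   : ∀ {C D} {t : Tm (C ∷ Γ) D} → Occurs (there x) t → Occurs x (lam t)
    o-app₁  : ∀ {C D} {t : Tm Γ (C ⇒ D)} {s : Tm Γ C} → Occurs x t → Occurs x (app t s)
    o-app₂  : ∀ {C D} {t : Tm Γ (C ⇒ D)} {s : Tm Γ C} → Occurs x s → Occurs x (app t s)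
    o-pair₁ : ∀ {C D} {t : Tm Γ C} {s : Tm Γ D} → Occurs x t → Occurs x (pair t s)
    o-pair₂ : ∀ {C D} {t : Tm Γ C} {s : Tm Γ D} → Occurs x s → Occurs x (pair t s)
    o-π₁    : ∀ {C D} {t : Tm Γ (C ∧ D)} → Occurs x t → Occurs x (π₁ t)
    o-π₂    : ∀ {C D} {t : Tm Γ (C ∧ D)} → Occurs x t → Occurs x (π₂ t)
    o-in₁   : ∀ {C D} {t : Tm Γ C} → Occurs x t → Occurs x (in₁ {B = D} t)
    o-in₂   : ∀ {C D} {t : Tm Γ D} → Occurs x t → Occurs x (in₂ {A = C} t)
    o-case₀ : ∀ {C D E} {t : Tm Γ (C ∨ D)} {t₁ : Tm (C ∷ Γ) E} {t₂ : Tm (D ∷ Γ) E} →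
              Occurs x t → Occurs x (case t t₁ t₂)
    o-case₁ : ∀ {C D E} {t : Tm Γ (C ∨ D)} {t₁ : Tm (C ∷ Γ) E} {t₂ : Tm (D ∷ Γ) E} →
              Occurs (there x) t₁ → Occurs x (case t t₁ t₂)
    o-case₂ : ∀ {C D E} {t : Tm Γ (C ∨ D)} {t₁ : Tm (C ∷ Γ) E} {t₂ : Tm (D ∷ Γ) E} →
              Occurs (there x) t₂ → Occurs x (case t t₁ t₂)
    o-efq   : ∀ {C} {t : Tm Γ ⊥'} → Occurs x t → Occurs x (efq {C = C} t)
    o-box₁  : ∀ {As B} {ts : Tms Γ (map □ As)} {s : Tm (As ++ Γ) B} →
              OccursTms x ts → Occurs x (box ts s)
    o-box₂  : ∀ {As B} {ts : Tms Γ (map □ As)} {s : Tm (As ++ Γ) B} →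
              Occurs (wkVar As x) s → Occurs x (box ts s)

  data OccursTms {Γ : Ctx} {A : Form} (x : Γ ∋ A) : ∀ {Bs} → Tms Γ Bs → Set where
    o-hd : ∀ {B Bs} {t : Tm Γ B} {ts : Tms Γ Bs} → Occurs x t → OccursTms x (t ∷ ts)
    o-tl : ∀ {B Bs} {t : Tm Γ B} {ts : Tms Γ Bs} → OccursTms x ts → OccursTms x (t ∷ ts)

HasOpenAssumption : ∀ {Γ A} → Tm Γ A → Set
HasOpenAssumption {Γ} t = Σ Form λ B → Σ (Γ ∋ B) λ x → Occurs x t

{-# OPTIONS --safe #-}
-- In a normal deduction the major premise of an elimination can be neither an
-- introduction (detour) nor a ∨- or ⊥-elimination (permutation or ⊥-conversion).
-- So following major premises from a neutral normal deduction only passes through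
-- →-, ∧-eliminations and finally reaches an assumption, which stays undischarged
-- because major premises of these rules discharge nothing.
module Submission where

open import Defs
open import Data.Product using (_,_)
open import Data.Empty using (⊥-elim)
open import Relation.Nullary using (¬_)
open import Data.List using (_∷_)

mapOpenAssumption : ∀ {Γ A C} {t : Tm Γ A} {u : Tm Γ C} →
                    (∀ {B} {x : Γ ∋ B} → Occurs x t → Occurs x u) →
                    HasOpenAssumption t → HasOpenAssumption u
mapOpenAssumption f (B , x , o) = B , x , f o

-- The neutral deductions that may be major premises of eliminations in normal deductions.
data Spinal {Γ : Ctx} : ∀ {A} → Tm Γ A → Set where
  s-var : ∀ {A} {x : Γ ∋ A} → Spinal (var x)
  s-app : ∀ {A B} {t : Tm Γ (A ⇒ B)} {s : Tm Γ A} → Spinal (app t s)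
  s-π₁  : ∀ {A B} {t : Tm Γ (A ∧ B)} → Spinal (π₁ t)
  s-π₂  : ∀ {A B} {t : Tm Γ (A ∧ B)} → Spinal (π₂ t)

module _ {Γ : Ctx} where

  app-major-spinal : ∀ {A B} {t : Tm Γ (A ⇒ B)} {s : Tm Γ A} → ¬ Redex (app t s) → Spinal t
  app-major-spinal {t = var _}      _ = s-var
  app-major-spinal {t = app _ _}    _ = s-app
  app-major-spinal {t = π₁ _}       _ = s-π₁
  app-major-spinal {t = π₂ _}       _ = s-π₂
  app-major-spinal {t = lam _}      r = ⊥-elim (r β-⇒)
  app-major-spinal {t = case _ _ _} r = ⊥-elim (r p-app)
  app-major-spinal {t = efq _}      r = ⊥-elim (r e-app)

  π₁-major-spinal : ∀ {A B} {t : Tm Γ (A ∧ B)} → ¬ Redex (π₁ t) → Spinal t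
  π₁-major-spinal {t = var _}      _ = s-var
  π₁-major-spinal {t = app _ _}    _ = s-app
  π₁-major-spinal {t = π₁ _}       _ = s-π₁
  π₁-major-spinal {t = π₂ _}       _ = s-π₂
  π₁-major-spinal {t = pair _ _}   r = ⊥-elim (r β-∧₁)
  π₁-major-spinal {t = case _ _ _} r = ⊥-elim (r p-π₁)
  π₁-major-spinal {t = efq _}      r = ⊥-elim (r e-π₁)

  π₂-major-spinal : ∀ {A B} {t : Tm Γ (A ∧ B)} → ¬ Redex (π₂ t) → Spinal t
  π₂-major-spinal {t = var _}      _ = s-var
  π₂-major-spinal {t = app _ _}    _ = s-app
  π₂-major-spinal {t = π₁ _}       _ = s-π₁
  π₂-major-spinal {t = π₂ _}       _ = s-π₂
  π₂-major-spinal {t = pair _ _}   r = ⊥-elim (r β-∧₂)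
  π₂-major-spinal {t = case _ _ _} r = ⊥-elim (r p-π₂)
  π₂-major-spinal {t = efq _}      r = ⊥-elim (r e-π₂)

  case-major-spinal : ∀ {A B C} {t : Tm Γ (A ∨ B)} {t₁ : Tm (A ∷ Γ) C} {t₂ : Tm (B ∷ Γ) C} →
                      ¬ Redex (case t t₁ t₂) → Spinal t
  case-major-spinal {t = var _}      _ = s-var
  case-major-spinal {t = app _ _}    _ = s-app
  case-major-spinal {t = π₁ _}       _ = s-π₁
  case-major-spinal {t = π₂ _}       _ = s-π₂
  case-major-spinal {t = in₁ _}      r = ⊥-elim (r β-∨₁)
  case-major-spinal {t = in₂ _}      r = ⊥-elim (r β-∨₂)
  case-major-spinal {t = case _ _ _} r = ⊥-elim (r p-case)
  case-major-spinal {t = efq _}      r = ⊥-elim (r e-case)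

  -- No introduction rule concludes ⊥', so only the permutable forms need excluding.
  efq-major-spinal : ∀ {C} {t : Tm Γ ⊥'} → ¬ Redex (efq {C = C} t) → Spinal t
  efq-major-spinal {t = var _}      _ = s-var
  efq-major-spinal {t = app _ _}    _ = s-app
  efq-major-spinal {t = π₁ _}       _ = s-π₁
  efq-major-spinal {t = π₂ _}       _ = s-π₂
  efq-major-spinal {t = case _ _ _} r = ⊥-elim (r p-efq)
  efq-major-spinal {t = efq _}      r = ⊥-elim (r e-efq)

  spinal-hasOpenAssumption : ∀ {A} {t : Tm Γ A} → Normal t → Spinal t → HasOpenAssumption t
  spinal-hasOpenAssumption {t = var x} _ s-var = _ , x , o-var
  spinal-hasOpenAssumption {t = app t s} (r , n , _) s-app =
    mapOpenAssumption o-app₁ (spinal-hasOpenAssumption n (app-major-spinal r))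
  spinal-hasOpenAssumption {t = π₁ t} (r , n) s-π₁ =
    mapOpenAssumption o-π₁ (spinal-hasOpenAssumption n (π₁-major-spinal r))
  spinal-hasOpenAssumption {t = π₂ t} (r , n) s-π₂ =
    mapOpenAssumption o-π₂ (spinal-hasOpenAssumption n (π₂-major-spinal r))

proposition29 : ∀ {Γ A} (t : Tm Γ A) → Normal t → Neutral t → HasOpenAssumption t
proposition29 (var _)    n n-var = spinal-hasOpenAssumption n s-var
proposition29 (app _ _)  n n-app = spinal-hasOpenAssumption n s-app
proposition29 (π₁ _)     n n-π₁  = spinal-hasOpenAssumption n s-π₁
proposition29 (π₂ _)     n n-π₂  = spinal-hasOpenAssumption n s-π₂
proposition29 (case t _ _) (r , n , _) n-case =
  mapOpenAssumption o-case₀ (spinal-hasOpenAssumption n (case-major-spinal r))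
proposition29 (efq t) (r , n) n-efq =
  mapOpenAssumption o-efq (spinal-hasOpenAssumption n (efq-major-spinal r))
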